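{- Let $s\in\mathbb{Z}\setminus\{0,1\}$ and let $D$ be a dominating set of $\Gamma(\mathbb{Z},\{1,s\})$, written as $D=\{x_i:i\in\mathbb{Z}\}$ with $x_i<x_{i+1}$ for all $i$, and let $b_i=x_{i+1}-x_i$ be the size of the block $B_i=\{x_i,x_i+1,\ldots,x_{i+1}-1\}$. (1) For each $i\in\mathbb{Z}$, $1\le b_i\le s+1$ if $s>0$, and $1\le b_i\le -s+2$ if $s<0$. (2) If $i\in\mathbb{Z}$ and $b_i\ge 3$, then $D$ contains $x_i-s+2,\,x_i-s+3,\,\ldots,\,x_i-s+b_i-1$.
   Context: The digraph $\Gamma(\mathbb{Z},\{1,s\})$ has vertex set $\mathbb{Z}$ and directed edges $(g,g+1)$ and $(g,g+s)$ for all $g\in\mathbb{Z}$. A vertex $u$ dominates $v$ if $u=v$ or $(u,v)$ is an edge; $D\subseteq\mathbb{Z}$ is a dominating set if every integer is dominated by some element of $D$. -}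

module Defs where

open import Data.Integer using (ℤ; _+_; +_)
open import Data.Product using (Σ; ∃; _×_)
open import Data.Sum using (_⊎_)
open import Relation.Binary.PropositionalEquality using (_≡_)

-- Domination in the Cayley digraph Γ(ℤ,{1,s}):
-- u dominates v iff u = v or (u,v) is an edge, i.e. v = u+1 or v = u+s.
Dominates : (s u v : ℤ) → Set
Dominates s u v = (u ≡ v) ⊎ ((u + + 1 ≡ v) ⊎ (u + s ≡ v))

IsDominatingSet : (s : ℤ) → (D : ℤ → Set) → Set
IsDominatingSet s D = (v : ℤ) → ∃ λ u → D u × Dominates s u v

module Submission where

-- No element of D lies strictly inside a block, so an interior point v of B_i with
-- v - 1 also interior is dominated neither by itself nor through the edge (v - 1, v);
-- hence v - s ∈ D.  Taking v = x_i + k gives (2).  A block longer than the bounds in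
-- (1) would contain such a v for which v - s is itself interior: v = x_i + s + 1 with
-- v - s = x_i + 1 when s > 0, and v = x_i + 2 with v - s = x_i + 2 - s when s < 0.

open import Defs
open import Data.Integer using (ℤ; _+_; _-_; -_; +_; ∣_∣; _≤_; _<_; _≤?_; 0ℤ; 1ℤ; -1ℤ; +<+)
open import Data.Integer.Properties
open import Data.Integer.Tactic.RingSolver using (solve-∀)
open import Data.Nat using (zero; suc; s≤s; z≤n)
open import Data.Product using (∃; _×_; _,_)
open import Data.Sum using (inj₁; inj₂)
open import Function.Bundles using (_⇔_; module Equivalence)
open import Relation.Binary.PropositionalEquality using (_≡_; _≢_; refl; sym; trans; cong; subst; subst₂)
open import Relation.Nullary using (¬_; yes; no; contradiction)

private
  i+j-j≡i : ∀ (i j : ℤ) → i + j - j ≡ i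
  i+j-j≡i = solve-∀

  i+[j-i]≡j : ∀ (i j : ℤ) → i + (j - i) ≡ j
  i+[j-i]≡j = solve-∀

  i+j-k≡i+[j-k] : ∀ (i j k : ℤ) → i + j - k ≡ i + (j - k)
  i+j-k≡i+[j-k] = solve-∀

  i+j-k≡i-k+j : ∀ (i j k : ℤ) → i + j - k ≡ i - k + j
  i+j-k≡i-k+j = solve-∀

  i+j-k≡i+[-k+j] : ∀ (i j k : ℤ) → i + j - k ≡ i + (- k + j)
  i+j-k≡i+[-k+j] = solve-∀

  i+[j+1]-j≡i+1 : ∀ (i j : ℤ) → i + (j + 1ℤ) - j ≡ i + 1ℤ
  i+[j+1]-j≡i+1 = solve-∀

  i-1<i : ∀ i → i - 1ℤ < i
  i-1<i i = i≤pred[j]⇒i<j (≤-reflexive (+-comm i -1ℤ))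

  i<i+j : ∀ i {j} → 0ℤ < j → i < i + j
  i<i+j i 0<j = subst (_< i + _) (+-identityʳ i) (+-monoʳ-< i 0<j)

dominated-via-s : ∀ {s D} → IsDominatingSet s D →
  ∀ v → ¬ D v → ¬ D (v - 1ℤ) → D (v - s)
dominated-via-s {s} {D} dom v v∉D v-1∉D with dom v
... | u , u∈D , inj₁ refl = contradiction u∈D v∉D
... | u , u∈D , inj₂ (inj₁ refl) = contradiction (subst D (sym (i+j-j≡i u 1ℤ)) u∈D) v-1∉D
... | u , u∈D , inj₂ (inj₂ refl) = subst D (sym (i+j-j≡i u s)) u∈D

module Increasing (x : ℤ → ℤ) (x-inc : ∀ i → x i < x (i + 1ℤ)) where

  x-mono-+ : ∀ i n → x i ≤ x (+ n + i)
  x-mono-+ i zero = ≤-reflexive (cong x (sym (+-identityˡ i)))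
  x-mono-+ i (suc n) = ≤-trans (x-mono-+ i n) (<⇒≤ (subst (λ k → x (+ n + i) < x k) step (x-inc (+ n + i))))
    where
    step : + n + i + 1ℤ ≡ + suc n + i
    step = trans (+-comm (+ n + i) 1ℤ) (sym (suc-+ n i))

  x-mono-≤ : ∀ {i j} → i ≤ j → x i ≤ x j
  x-mono-≤ {i} {j} i≤j = subst (λ k → x i ≤ x k) n+i≡j (x-mono-+ i ∣ j - i ∣)
    where
    n+i≡j : + ∣ j - i ∣ + i ≡ j
    n+i≡j = trans (cong (_+ i) (0≤i⇒+∣i∣≡i (i≤j⇒0≤j-i i≤j)))
               (trans (+-comm (j - i) i) (i+[j-i]≡j i j))

module Blocks (D : ℤ → Set) (x : ℤ → ℤ) (x-inc : ∀ i → x i < x (i + 1ℤ))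
              (D⇔x : ∀ n → D n ⇔ (∃ λ i → x i ≡ n)) where

  open Increasing x x-inc

  blockSize : ℤ → ℤ
  blockSize i = x (i + 1ℤ) - x i

  blockSize-positive : ∀ i → 0ℤ < blockSize i
  blockSize-positive i = subst (_< blockSize i) (+-inverseʳ (x i)) (+-monoˡ-< (- x i) (x-inc i))

  interior∉D : ∀ i {c} → 0ℤ < c → c < blockSize i → ¬ D (x i + c)
  interior∉D i {c} 0<c c<b x+c∈D with Equivalence.to (D⇔x (x i + c)) x+c∈D
  ... | j , xj≡x+c with j ≤? i
  ...   | yes j≤i = <⇒≱ (subst (x i <_) (sym xj≡x+c) (i<i+j (x i) 0<c)) (x-mono-≤ j≤i)
  ...   | no j≰i = <⇒≱ xj<x[i+1] (x-mono-≤ (subst (_≤ j) (+-comm 1ℤ i) (i<j⇒suc[i]≤j (≰⇒> j≰i))))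
    where
    xj<x[i+1] : x j < x (i + 1ℤ)
    xj<x[i+1] = subst₂ _<_ (sym xj≡x+c) (i+[j-i]≡j (x i) (x (i + 1ℤ))) (+-monoʳ-< (x i) c<b)

module DominatingBlocks (s : ℤ) (D : ℤ → Set) (dom : IsDominatingSet s D)
                        (x : ℤ → ℤ) (x-inc : ∀ i → x i < x (i + 1ℤ))
                        (D⇔x : ∀ n → D n ⇔ (∃ λ i → x i ≡ n)) where

  open Blocks D x x-inc D⇔x

  interior-s∈D : ∀ i {c} → 1ℤ < c → c < blockSize i → D (x i + c - s)
  interior-s∈D i {c} 1<c c<b = dominated-via-s dom (x i + c) (interior∉D i 0<c c<b) v-1∉D
    where
    0<c : 0ℤ < c
    0<c = <-trans (+<+ (s≤s z≤n)) 1<c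
    v-1∉D : ¬ D (x i + c - 1ℤ)
    v-1∉D = subst (λ v → ¬ D v) (sym (i+j-k≡i+[j-k] (x i) c 1ℤ))
                  (interior∉D i (+-monoˡ-< -1ℤ 1<c) (<-trans (i-1<i c) c<b))

  blockSize≤s+1 : 0ℤ < s → ∀ i → blockSize i ≤ s + 1ℤ
  blockSize≤s+1 0<s i = ≮⇒≥ λ s+1<b →
    interior∉D i (+<+ (s≤s z≤n)) (<-trans 1<s+1 s+1<b)
      (subst D (i+[j+1]-j≡i+1 (x i) s) (interior-s∈D i 1<s+1 s+1<b))
    where
    1<s+1 : 1ℤ < s + 1ℤ
    1<s+1 = +-monoˡ-< 1ℤ 0<s

  blockSize≤2-s : s < 0ℤ → ∀ i → blockSize i ≤ - s + + 2
  blockSize≤2-s s<0 i = ≮⇒≥ λ 2-s<b →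
    interior∉D i (<-trans (+<+ (s≤s z≤n)) 2<2-s) 2-s<b
      (subst D (i+j-k≡i+[-k+j] (x i) (+ 2) s) (interior-s∈D i (+<+ (s≤s (s≤s z≤n))) (<-trans 2<2-s 2-s<b)))
    where
    2<2-s : + 2 < - s + + 2
    2<2-s = +-monoˡ-< (+ 2) (neg-mono-< s<0)

  shifted-interior⊆D : ∀ i k → + 2 ≤ k → k ≤ blockSize i - 1ℤ → D (x i - s + k)
  shifted-interior⊆D i k 2≤k k≤b-1 =
    subst D (i+j-k≡i-k+j (x i) k s)
      (interior-s∈D i (suc[i]≤j⇒i<j 2≤k) (i≤pred[j]⇒i<j (subst (k ≤_) (+-comm (blockSize i) -1ℤ) k≤b-1)))

lemma4p2 : (s : ℤ) → s ≢ 0ℤ → s ≢ 1ℤ →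
    (D : ℤ → Set) → IsDominatingSet s D →
    (x : ℤ → ℤ) → (∀ i → x i < x (i + 1ℤ)) →
    (∀ n → D n ⇔ (∃ λ i → x i ≡ n)) →
    ((∀ i → (1ℤ ≤ x (i + 1ℤ) - x i)
        × (0ℤ < s → x (i + 1ℤ) - x i ≤ s + 1ℤ)
        × (s < 0ℤ → x (i + 1ℤ) - x i ≤ - s + + 2))
    × (∀ i → + 3 ≤ x (i + 1ℤ) - x i →
        ∀ k → + 2 ≤ k → k ≤ x (i + 1ℤ) - x i - 1ℤ →
        D (x i - s + k)))
lemma4p2 s _ _ D dom x x-inc D⇔x = blockBounds , (λ i _ → shifted-interior⊆D i)
  where
  open Blocks D x x-inc D⇔x
  open DominatingBlocks s D dom x x-inc D⇔x

  blockBounds : ∀ i → (1ℤ ≤ blockSize i)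
                    × (0ℤ < s → blockSize i ≤ s + 1ℤ)
                    × (s < 0ℤ → blockSize i ≤ - s + + 2)
  blockBounds i = i<j⇒suc[i]≤j (blockSize-positive i)
                , (λ 0<s → blockSize≤s+1 0<s i)
                , (λ s<0 → blockSize≤2-s s<0 i)
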